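{- For each $n\ge 1$ let $S$ be a subset of $\mathbb{Z}/n\mathbb{Z}$ chosen uniformly at random among all $2^n$ subsets. Then \[ \mathbb{P}\big(|S+S|=|S-S|=n\big)\longrightarrow 1\quad\text{as } n\to\infty . \]
   Context: For $S\subseteq \mathbb{Z}/n\mathbb{Z}$, $S+S=\{x+y: x,y\in S\}$ and $S-S=\{x-y: x,y\in S\}$, with operations modulo $n$. -}

module Defs where

open import Data.Nat using (ℕ; zero; suc; _+_; _∸_; _≟_)
open import Data.Nat.DivMod using (_%_)
open import Data.Bool using (Bool; true; false)
open import Data.Fin using (Fin; toℕ)
open import Data.Fin.Properties using (any?)
open import Data.Fin.Subset using (Subset; _∈_; ∣_∣)
open import Data.Fin.Subset.Properties using (_∈?_)
open import Data.Vec using (Vec; []; _∷_; tabulate)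
open import Data.List using (List; [_]; map; _++_; filter; length)
open import Data.Product using (_×_)
open import Relation.Nullary using (does)
open import Relation.Nullary.Decidable using (_×-dec_)
open import Relation.Binary.PropositionalEquality using (_≡_)

-- Z/nZ is represented by Fin n (with n = suc m, so n ≥ 1), elements
-- identified with their residues 0..n-1; arithmetic is done modulo n.

sumset : ∀ {m} → Subset (suc m) → Subset (suc m)
sumset {m} S = tabulate λ z → does
  (any? λ x → any? λ y →
     (x ∈? S) ×-dec ((y ∈? S) ×-dec (toℕ z ≟ (toℕ x + toℕ y) % suc m)))

diffset : ∀ {m} → Subset (suc m) → Subset (suc m)
diffset {m} S = tabulate λ z → does
  (any? λ x → any? λ y →
     (x ∈? S) ×-dec ((y ∈? S) ×-dec (toℕ z ≟ (toℕ x + (suc m ∸ toℕ y)) % suc m)))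

allSubsets : (n : ℕ) → List (Subset n)
allSubsets zero = [ [] ]
allSubsets (suc n) = map (true ∷_) (allSubsets n) ++ map (false ∷_) (allSubsets n)

Good : ∀ {m} → Subset (suc m) → Set
Good {m} S = (∣ sumset S ∣ ≡ suc m) × (∣ diffset S ∣ ≡ suc m)

good? : ∀ {m} (S : Subset (suc m)) → Relation.Nullary.Dec (Good S)
good? {m} S = (∣ sumset S ∣ ≟ suc m) ×-dec (∣ diffset S ∣ ≟ suc m)

goodCount : ℕ → ℕ
goodCount m = length (filter good? (allSubsets (suc m)))

-- A uniformly random S ⊆ ℤ/nℤ is a uniformly random bit vector of length n. Fix a residue z
-- and L pairwise disjoint pairs {a i, b i} with a i + b i ≡ z (resp. a i - b i ≡ z). The L
-- events "a i, b i ∈ S" are independent of probability 1/4 each, so z ∉ S + S (resp. S - S)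
-- has probability at most (3/4)^L. Such pairs exist for every z once 4L ≤ n and 2L² ≤ n, so
-- L can be taken of order log n, and a union bound over the 2n events z ∉ S ± S bounds the
-- probability that S + S or S - S is not everything by 2n (3/4)^L → 0.

module Submission where

open import Defs
import Algebra.Properties.CommutativeSemigroup as CommSemigroupProperties
open import Data.Bool using (Bool; true; false; not; _∧_; _∨_; if_then_else_)
open import Data.Bool.Properties using (∨-identityʳ; ∨-zeroʳ; ∨-∧-booleanAlgebra)
open import Data.Fin using (Fin; toℕ; fromℕ<)
open import Data.Fin.Properties using (toℕ-fromℕ<; toℕ<n; any?)
open import Data.Fin.Subset using (Subset; ⊤; ∣_∣; _∈_)
open import Data.Fin.Subset.Properties using (_∈?_; ∣⊤∣≡n)
open import Data.List using (List; []; _∷_; _++_; map; filter; length)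
open import Data.List.Properties using (length-++; filter-++)
open import Data.Nat
open import Data.Nat.DivMod using (_%_; [m+n]%n≡m%n; m<n⇒m%n≡m; n%n≡0)
open import Data.Nat.Properties
open import Data.Nat.Tactic.RingSolver using (solve-∀)
open import Data.Product using (∃-syntax; _×_; _,_; proj₁; proj₂)
open import Data.Unit using (tt)
open import Data.Vec using (Vec; []; _∷_; lookup; tabulate)
open import Data.Vec.Properties using (lookup∘tabulate; lookup⇒[]=)
open import Function using (_∘_)
open import Level using (0ℓ)
open import Relation.Binary.PropositionalEquality
open import Relation.Nullary using (does; yes; no)
open import Relation.Nullary.Decidable using (dec-true; _×-dec_)
open import Relation.Nullary.Negation using (contradiction)
open import Relation.Unary using (Pred; Decidable)

open import Algebra.Lattice.Properties.BooleanAlgebra ∨-∧-booleanAlgebra using (deMorgan₁)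
open CommSemigroupProperties +-commutativeSemigroup using ()
  renaming (interchange to +-interchange)
open CommSemigroupProperties *-commutativeSemigroup using ()
  renaming (interchange to *-interchange; x∙yz≈y∙xz to x*[y*z]≡y*[x*z])

-- Counting bit vectors

count : ∀ n → (Vec Bool n → Bool) → ℕ
count zero    P = if P [] then 1 else 0
count (suc n) P = count n (λ v → P (true ∷ v)) + count n (λ v → P (false ∷ v))

count-cong : ∀ n {P Q : Vec Bool n → Bool} → (∀ v → P v ≡ Q v) → count n P ≡ count n Q
count-cong zero    P≗Q rewrite P≗Q [] = refl
count-cong (suc n) P≗Q =
  cong₂ _+_ (count-cong n λ v → P≗Q (true ∷ v)) (count-cong n λ v → P≗Q (false ∷ v))

count-mono : ∀ n {P Q : Vec Bool n → Bool} → (∀ v → P v ≡ true → Q v ≡ true) →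
             count n P ≤ count n Q
count-mono zero {P} P⇒Q with P [] in P[]
... | true  rewrite P⇒Q [] P[] = ≤-refl
... | false = z≤n
count-mono (suc n) P⇒Q =
  +-mono-≤ (count-mono n λ v → P⇒Q (true ∷ v)) (count-mono n λ v → P⇒Q (false ∷ v))

count-not-mono : ∀ n {P Q : Vec Bool n → Bool} → (∀ v → Q v ≡ true → P v ≡ true) →
                 count n (not ∘ P) ≤ count n (not ∘ Q)
count-not-mono n {P} {Q} Q⇒P = count-mono n contraposition
  where
  contraposition : ∀ v → not (P v) ≡ true → not (Q v) ≡ true
  contraposition v ¬Pv with Q v in Qv
  ... | false = refl
  ... | true  = contradiction (trans (cong not (sym (Q⇒P v Qv))) ¬Pv) λ ()

count-true : ∀ n → count n (λ _ → true) ≡ 2 ^ n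
count-true zero    = refl
count-true (suc n) = cong₂ _+_ (count-true n) (trans (count-true n) (sym (+-identityʳ _)))

count-false : ∀ n → count n (λ _ → false) ≡ 0
count-false zero    = refl
count-false (suc n) = cong₂ _+_ (count-false n) (count-false n)

count-+-count-not : ∀ n (P : Vec Bool n → Bool) → count n P + count n (not ∘ P) ≡ 2 ^ n
count-+-count-not zero P with P []
... | true  = refl
... | false = refl
count-+-count-not (suc n) P = begin
  (a + b) + (c + d)  ≡⟨ +-interchange a b c d ⟩
  (a + c) + (b + d)  ≡⟨ cong₂ _+_ (count-+-count-not n _)
                                  (trans (count-+-count-not n _) (sym (+-identityʳ _))) ⟩
  2 ^ suc n          ∎
  where
  open ≡-Reasoning
  a = count n (λ v → P (true ∷ v))
  b = count n (λ v → P (false ∷ v))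
  c = count n (λ v → not (P (true ∷ v)))
  d = count n (λ v → not (P (false ∷ v)))

count-∨ : ∀ n (P Q : Vec Bool n → Bool) → count n (λ v → P v ∨ Q v) ≤ count n P + count n Q
count-∨ zero P Q with P [] | Q []
... | true  | true  = s≤s z≤n
... | true  | false = ≤-refl
... | false | _     = ≤-refl
count-∨ (suc n) P Q = ≤-trans
  (+-mono-≤ (count-∨ n (λ v → P (true ∷ v)) (λ v → Q (true ∷ v)))
            (count-∨ n (λ v → P (false ∷ v)) (λ v → Q (false ∷ v))))
  (≤-reflexive (+-interchange (count n (λ v → P (true ∷ v))) (count n (λ v → Q (true ∷ v)))
                              (count n (λ v → P (false ∷ v))) (count n (λ v → Q (false ∷ v)))))

count-not-∧ : ∀ n (P Q : Vec Bool n → Bool) →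
              count n (λ v → not (P v ∧ Q v)) ≤ count n (not ∘ P) + count n (not ∘ Q)
count-not-∧ n P Q = ≤-trans (≤-reflexive (count-cong n λ v → deMorgan₁ (P v) (Q v)))
                            (count-∨ n (not ∘ P) (not ∘ Q))

bit : ∀ {n} → Vec Bool n → ℕ → Bool
bit []      _       = false
bit (x ∷ _) zero    = x
bit (_ ∷ v) (suc k) = bit v k

setBit : ∀ {n} → Vec Bool n → ℕ → Bool → Vec Bool n
setBit []      _       _ = []
setBit (_ ∷ v) zero    x = x ∷ v
setBit (y ∷ v) (suc k) x = y ∷ setBit v k x

bit-setBit-same : ∀ {n} (v : Vec Bool n) {k} x → k < n → bit (setBit v k x) k ≡ x
bit-setBit-same (_ ∷ v) {zero}  x _         = refl
bit-setBit-same (_ ∷ v) {suc k} x (s≤s k<n) = bit-setBit-same v x k<n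

bit-setBit-other : ∀ {n} (v : Vec Bool n) {j k} x → j ≢ k → bit (setBit v k x) j ≡ bit v j
bit-setBit-other []      {j}     {k}     x j≢k = refl
bit-setBit-other (_ ∷ v) {zero}  {zero}  x j≢k = contradiction refl j≢k
bit-setBit-other (_ ∷ v) {zero}  {suc k} x j≢k = refl
bit-setBit-other (_ ∷ v) {suc j} {zero}  x j≢k = refl
bit-setBit-other (_ ∷ v) {suc j} {suc k} x j≢k = bit-setBit-other v x (j≢k ∘ cong suc)

bit-lookup : ∀ {n} (v : Vec Bool n) (x : Fin n) → bit v (toℕ x) ≡ lookup v x
bit-lookup (_ ∷ v) Fin.zero    = refl
bit-lookup (_ ∷ v) (Fin.suc x) = bit-lookup v x

count-split : ∀ n (P : Vec Bool n → Bool) {k} → k < n →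
  2 * count n P ≡ count n (λ v → P (setBit v k true)) + count n (λ v → P (setBit v k false))
count-split (suc n) P {zero} _ =
  double-+ (count n (λ v → P (true ∷ v))) (count n (λ v → P (false ∷ v)))
  where
  double-+ : ∀ a b → 2 * (a + b) ≡ (a + a) + (b + b)
  double-+ = solve-∀
count-split (suc n) P {suc k} (s≤s k<n) = begin
  2 * (a + b)        ≡⟨ *-distribˡ-+ 2 a b ⟩
  2 * a + 2 * b      ≡⟨ cong₂ _+_ (count-split n _ k<n) (count-split n _ k<n) ⟩
  (c + d) + (e + f)  ≡⟨ +-interchange c d e f ⟩
  (c + e) + (d + f)  ∎
  where
  open ≡-Reasoning
  a = count n (λ v → P (true ∷ v))
  b = count n (λ v → P (false ∷ v))
  c = count n (λ v → P (true ∷ setBit v k true))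
  d = count n (λ v → P (true ∷ setBit v k false))
  e = count n (λ v → P (false ∷ setBit v k true))
  f = count n (λ v → P (false ∷ setBit v k false))

-- Each of the four settings of the bits p and q contributes count n (not ∘ R), except
-- p = q = true, which contributes nothing.
count-forbid-pair : ∀ n (P R : Vec Bool n → Bool) {p q} → p < n → q < n →
  (∀ v x y → P (setBit (setBit v q y) p x) ≡ R v ∨ (x ∧ y)) →
  4 * count n (not ∘ P) ≡ 3 * count n (not ∘ R)
count-forbid-pair n P R {p} {q} p<n q<n fix = begin
  4 * count n (not ∘ P)                          ≡⟨ *-assoc 2 2 (count n (not ∘ P)) ⟩
  2 * (2 * count n (not ∘ P))                    ≡⟨ cong (2 *_) (count-split n _ p<n) ⟩
  2 * (count n (¬P-at true) + count n (¬P-at false))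
                                                 ≡⟨ *-distribˡ-+ 2 (count n (¬P-at true)) (count n (¬P-at false)) ⟩
  2 * count n (¬P-at true) + 2 * count n (¬P-at false)
                                                 ≡⟨ cong₂ _+_ (count-split n _ q<n) (count-split n _ q<n) ⟩
  (fixed true true + fixed true false) + (fixed false true + fixed false false)
                                                 ≡⟨ cong₂ _+_ (cong₂ _+_ both-set (free refl))
                                                             (cong₂ _+_ (free refl) (free refl)) ⟩
  (0 + r) + (r + r)                              ≡⟨ three-times r ⟩
  3 * r                                          ∎
  where
  open ≡-Reasoning
  r = count n (not ∘ R)
  ¬P-at : Bool → Vec Bool n → Bool
  ¬P-at x v = not (P (setBit v p x))
  fixed : Bool → Bool → ℕ
  fixed x y = count n (λ v → not (P (setBit (setBit v q y) p x)))
  both-set : fixed true true ≡ 0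
  both-set = trans (count-cong n λ v → trans (cong not (fix v true true)) (cong not (∨-zeroʳ (R v))))
                   (count-false n)
  free : ∀ {x y} → (x ∧ y) ≡ false → fixed x y ≡ r
  free {x} {y} x∧y≡false = count-cong n λ v → cong not (begin
    P (setBit (setBit v q y) p x)  ≡⟨ fix v x y ⟩
    R v ∨ (x ∧ y)                  ≡⟨ cong (R v ∨_) x∧y≡false ⟩
    R v ∨ false                    ≡⟨ ∨-identityʳ (R v) ⟩
    R v                            ∎)
  three-times : ∀ r → (0 + r) + (r + r) ≡ 3 * r
  three-times = solve-∀

-- Disjoint pairs of positions

record DisjointPairs (n L : ℕ) (a b : ℕ → ℕ) : Set where
  field
    a<n         : ∀ {i} → i < L → a i < n
    b<n         : ∀ {i} → i < L → b i < n
    a≢b         : ∀ {i j} → i < L → j < L → a i ≢ b j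
    a-injective : ∀ {i j} → i < L → j < L → a i ≡ a j → i ≡ j
    b-injective : ∀ {i j} → i < L → j < L → b i ≡ b j → i ≡ j

  swap : DisjointPairs n L b a
  swap = record
    { a<n = b<n ; b<n = a<n ; a≢b = λ i<L j<L bi≡aj → a≢b j<L i<L (sym bi≡aj)
    ; a-injective = b-injective ; b-injective = a-injective }

  restrict : ∀ {K} → K ≤ L → DisjointPairs n K a b
  restrict {K} K≤L = record
    { a<n = a<n ∘ weaken ; b<n = b<n ∘ weaken
    ; a≢b = λ i<K j<K → a≢b (weaken i<K) (weaken j<K)
    ; a-injective = λ i<K j<K → a-injective (weaken i<K) (weaken j<K)
    ; b-injective = λ i<K j<K → b-injective (weaken i<K) (weaken j<K) }
    where
    weaken : ∀ {i} → i < K → i < L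
    weaken i<K = <-≤-trans i<K K≤L

module _ {n : ℕ} (a b : ℕ → ℕ) where

  containsPair : ℕ → Vec Bool n → Bool
  containsPair zero    v = false
  containsPair (suc L) v = containsPair L v ∨ (bit v (a L) ∧ bit v (b L))

  containsPair-sound : ∀ L v → containsPair L v ≡ true →
                       ∃[ i ] (i < L × bit v (a i) ≡ true × bit v (b i) ≡ true)
  containsPair-sound (suc L) v contains
    with containsPair L v in containsL | bit v (a L) in aL | bit v (b L) in bL
  ... | true  | _    | _    with i , i<L , ai , bi ← containsPair-sound L v containsL
                            = i , m<n⇒m<1+n i<L , ai , bi
  ... | false | true | true = L , ≤-refl , aL , bL

  containsPair-setBit : ∀ L v {p} x → (∀ {i} → i < L → p ≢ a i × p ≢ b i) →
                        containsPair L (setBit v p x) ≡ containsPair L v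
  containsPair-setBit zero    v x fresh = refl
  containsPair-setBit (suc L) v x fresh
    rewrite containsPair-setBit L v x (fresh ∘ m<n⇒m<1+n)
          | bit-setBit-other v x (proj₁ (fresh ≤-refl) ∘ sym)
          | bit-setBit-other v x (proj₂ (fresh ≤-refl) ∘ sym) = refl

count-avoiding : ∀ {n L a b} → DisjointPairs n L a b →
                 4 ^ L * count n (not ∘ containsPair a b L) ≡ 3 ^ L * 2 ^ n
count-avoiding {n} {zero} _ =
  trans (*-identityˡ _) (trans (count-true n) (sym (*-identityˡ _)))
count-avoiding {n} {suc L} {a} {b} pairs = begin
  4 ^ suc L * count n (not ∘ containsPair a b (suc L))  ≡⟨ *-assoc 4 (4 ^ L) _ ⟩
  4 * (4 ^ L * count n (not ∘ containsPair a b (suc L)))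
        ≡⟨ x*[y*z]≡y*[x*z] 4 (4 ^ L) _ ⟩
  4 ^ L * (4 * count n (not ∘ containsPair a b (suc L)))
        ≡⟨ cong (4 ^ L *_) (count-forbid-pair n _ _ (a<n ≤-refl) (b<n ≤-refl) fix-last-pair) ⟩
  4 ^ L * (3 * count n (not ∘ containsPair a b L))       ≡⟨ x*[y*z]≡y*[x*z] (4 ^ L) 3 _ ⟩
  3 * (4 ^ L * count n (not ∘ containsPair a b L))       ≡⟨ cong (3 *_) (count-avoiding (restrict (n≤1+n L))) ⟩
  3 * (3 ^ L * 2 ^ n)                                    ≡⟨ *-assoc 3 (3 ^ L) (2 ^ n) ⟨
  3 ^ suc L * 2 ^ n                                      ∎
  where
  open ≡-Reasoning
  open DisjointPairs pairs
  fresh-a : ∀ {i} → i < L → a L ≢ a i × a L ≢ b i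
  fresh-a i<L = (λ aL≡ai → <⇒≢ i<L (sym (a-injective ≤-refl (m<n⇒m<1+n i<L) aL≡ai)))
              , a≢b ≤-refl (m<n⇒m<1+n i<L)
  fresh-b : ∀ {i} → i < L → b L ≢ a i × b L ≢ b i
  fresh-b i<L = (λ bL≡ai → a≢b (m<n⇒m<1+n i<L) ≤-refl (sym bL≡ai))
              , (λ bL≡bi → <⇒≢ i<L (sym (b-injective ≤-refl (m<n⇒m<1+n i<L) bL≡bi)))
  fix-last-pair : ∀ v x y → containsPair a b (suc L) (setBit (setBit v (b L) y) (a L) x)
                          ≡ containsPair a b L v ∨ (x ∧ y)
  fix-last-pair v x y
    rewrite containsPair-setBit a b L (setBit v (b L) y) x fresh-a
          | containsPair-setBit a b L v y fresh-b
          | bit-setBit-same (setBit v (b L) y) x (a<n ≤-refl)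
          | bit-setBit-other (setBit v (b L) y) x (λ bL≡aL → a≢b ≤-refl ≤-refl (sym bL≡aL))
          | bit-setBit-same v y (b<n ≤-refl) = refl

count-missing-≤ : ∀ {n L a b} → DisjointPairs n L a b → (D : Vec Bool n → Bool) →
  (∀ v {i} → i < L → bit v (a i) ≡ true → bit v (b i) ≡ true → D v ≡ true) →
  4 ^ L * count n (not ∘ D) ≤ 3 ^ L * 2 ^ n
count-missing-≤ {n} {L} {a} {b} pairs D pair⇒D = begin
  4 ^ L * count n (not ∘ D)                   ≤⟨ *-monoʳ-≤ (4 ^ L) (count-not-mono n containsPair⇒D) ⟩
  4 ^ L * count n (not ∘ containsPair a b L)  ≡⟨ count-avoiding pairs ⟩
  3 ^ L * 2 ^ n                               ∎
  where
  open ≤-Reasoning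
  containsPair⇒D : ∀ v → containsPair a b L v ≡ true → D v ≡ true
  containsPair⇒D v contains with i , i<L , ai , bi ← containsPair-sound a b L v contains
    = pair⇒D v i<L ai bi

-- Sums and differences in ℤ/nℤ

-- sumset and diffset are, definitionally, pairset (λ x y → (x + y) % n) and
-- pairset (λ x y → (x + (n ∸ y)) % n).
pairset : ∀ {n} → (ℕ → ℕ → ℕ) → Subset n → Subset n
pairset _⊕_ S = tabulate λ z → does (any? λ x → any? λ y →
  (x ∈? S) ×-dec ((y ∈? S) ×-dec (toℕ z ≟ toℕ x ⊕ toℕ y)))

pairset-hit : ∀ {n} (_⊕_ : ℕ → ℕ → ℕ) (S : Subset n) (z : Fin n) {a b} → a < n → b < n →
  bit S a ≡ true → bit S b ≡ true → a ⊕ b ≡ toℕ z → lookup (pairset _⊕_ S) z ≡ true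
pairset-hit {n} _⊕_ S z {a} {b} a<n b<n a∈S b∈S a⊕b≡z =
  trans (lookup∘tabulate _ z)
        (dec-true (any? _) (fromℕ< a<n , fromℕ< b<n , member a<n a∈S , member b<n b∈S , z≡x⊕y))
  where
  member : ∀ {c} (c<n : c < n) → bit S c ≡ true → fromℕ< c<n ∈ S
  member c<n c∈S = lookup⇒[]= _ S (trans (sym (bit-lookup S _)) (trans (cong (bit S) (toℕ-fromℕ< c<n)) c∈S))
  z≡x⊕y : toℕ z ≡ toℕ (fromℕ< a<n) ⊕ toℕ (fromℕ< b<n)
  z≡x⊕y = trans (sym a⊕b≡z) (sym (cong₂ _⊕_ (toℕ-fromℕ< a<n) (toℕ-fromℕ< b<n)))

[m+o+[n∸o]]%n≡m : ∀ {m n o} .{{_ : NonZero n}} → o ≤ n → m < n → (m + o + (n ∸ o)) % n ≡ m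
[m+o+[n∸o]]%n≡m {m} {n} {o} o≤n m<n = begin
  (m + o + (n ∸ o)) % n    ≡⟨ cong (_% n) (+-assoc m o (n ∸ o)) ⟩
  (m + (o + (n ∸ o))) % n  ≡⟨ cong (λ t → (m + t) % n) (m+[n∸m]≡n o≤n) ⟩
  (m + n) % n              ≡⟨ [m+n]%n≡m%n m n ⟩
  m % n                    ≡⟨ m<n⇒m%n≡m m<n ⟩
  m                        ∎
  where open ≡-Reasoning

pairs-with-sum : ∀ {n L z} .{{_ : NonZero n}} → z < n → 4 * L ≤ n →
  ∃[ a ] ∃[ b ] (DisjointPairs n L a b × (∀ {i} → i < L → (a i + b i) % n ≡ z))
pairs-with-sum {n} {L} {z} z<n 4L≤n with 2 * L ≤? z
... | yes 2L≤z = (λ i → i) , (z ∸_) , pairs , sums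
  where
  i≤z : ∀ {i} → i < L → i ≤ z
  i≤z i<L = ≤-trans (<⇒≤ i<L) (≤-trans (m≤m+n L _) 2L≤z)
  L≤z∸j : ∀ {j} → j < L → L ≤ z ∸ j
  L≤z∸j {j} j<L = m+n≤o⇒m≤o∸n L (≤-trans (+-monoʳ-≤ L (<⇒≤ j<L))
                                        (≤-trans (≤-reflexive (cong (L +_) (sym (+-identityʳ L)))) 2L≤z))
  pairs : DisjointPairs n L (λ i → i) (z ∸_)
  pairs = record
    { a<n = λ i<L → ≤-<-trans (i≤z i<L) z<n
    ; b<n = λ {i} _ → ≤-<-trans (m∸n≤m z i) z<n
    ; a≢b = λ i<L j<L → <⇒≢ (<-≤-trans i<L (L≤z∸j j<L))
    ; a-injective = λ _ _ i≡j → i≡j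
    ; b-injective = λ i<L j<L → ∸-cancelˡ-≡ (i≤z i<L) (i≤z j<L) }
  sums : ∀ {i} → i < L → (i + (z ∸ i)) % n ≡ z
  sums i<L = trans (cong (_% n) (m+[n∸m]≡n (i≤z i<L))) (m<n⇒m%n≡m z<n)
... | no 2L≰z = (λ i → z + suc i) , (λ i → n ∸ suc i) , pairs , sums
  where
  z+L<n∸L : z + L < n ∸ L
  z+L<n∸L = m+n≤o⇒m≤o∸n (suc (z + L)) (≤-trans (+-monoˡ-≤ L (+-monoˡ-≤ L (≰⇒> 2L≰z)))
                                                (≤-trans (≤-reflexive (2L+L+L≡4L L)) 4L≤n))
    where
    2L+L+L≡4L : ∀ L → 2 * L + L + L ≡ 4 * L
    2L+L+L≡4L = solve-∀
  a≤z+L : ∀ {i} → i < L → z + suc i ≤ z + L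
  a≤z+L i<L = +-monoʳ-≤ z i<L
  1+i≤n : ∀ {i} → i < L → suc i ≤ n
  1+i≤n i<L = ≤-trans i<L (≤-trans (m≤n*m L 4) 4L≤n)
  pairs : DisjointPairs n L (λ i → z + suc i) (λ i → n ∸ suc i)
  pairs = record
    { a<n = λ i<L → <-≤-trans (≤-<-trans (a≤z+L i<L) z+L<n∸L) (m∸n≤m n L)
    ; b<n = λ i<L → ∸-monoʳ-< z<s (1+i≤n i<L)
    ; a≢b = λ i<L j<L → <⇒≢ (<-≤-trans (≤-<-trans (a≤z+L i<L) z+L<n∸L) (∸-monoʳ-≤ n j<L))
    ; a-injective = λ _ _ → suc-injective ∘ +-cancelˡ-≡ z _ _
    ; b-injective = λ i<L j<L → suc-injective ∘ ∸-cancelˡ-≡ (1+i≤n i<L) (1+i≤n j<L) }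
  sums : ∀ {i} → i < L → (z + suc i + (n ∸ suc i)) % n ≡ z
  sums i<L = [m+o+[n∸o]]%n≡m (1+i≤n i<L) z<n

-- For small differences e the pairs (e + i, i) overlap; interleaving them as
-- (e(2i+1), 2ei) keeps them disjoint.
module Interleaved {n L e : ℕ} .{{_ : NonZero n}} (e>0 : e > 0) (fits : e * (2 * L) ≤ n) where

  private instance
    e-nonZero : NonZero e
    e-nonZero = >-nonZero e>0

  low high : ℕ → ℕ
  low i  = e * (2 * i)
  high i = e * suc (2 * i)

  high<n : ∀ {i} → i < L → high i < n
  high<n {i} i<L = begin-strict
    high i          <⟨ m<m+n (high i) e>0 ⟩
    high i + e      ≡⟨ high+e≡e*2[1+i] e i ⟩
    e * (2 * suc i) ≤⟨ *-monoʳ-≤ e (*-monoʳ-≤ 2 i<L) ⟩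
    e * (2 * L)     ≤⟨ fits ⟩
    n               ∎
    where
    open ≤-Reasoning
    high+e≡e*2[1+i] : ∀ e i → e * suc (2 * i) + e ≡ e * (2 * suc i)
    high+e≡e*2[1+i] = solve-∀

  e+low<n : ∀ {i} → i < L → e + low i < n
  e+low<n {i} i<L = subst (_< n) (*-suc e (2 * i)) (high<n i<L)

  pairs : DisjointPairs n L high low
  pairs = record
    { a<n = high<n
    ; b<n = λ i<L → ≤-<-trans (m≤n+m _ e) (e+low<n i<L)
    ; a≢b = λ {i} {j} _ _ → even≢odd j i ∘ sym ∘ *-cancelˡ-≡ _ _ e
    ; a-injective = λ _ _ → *-cancelˡ-≡ _ _ 2 ∘ suc-injective ∘ *-cancelˡ-≡ _ _ e
    ; b-injective = λ _ _ → *-cancelˡ-≡ _ _ 2 ∘ *-cancelˡ-≡ _ _ e }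

  high-low : ∀ {i} → i < L → (high i + (n ∸ low i)) % n ≡ e
  high-low {i} i<L rewrite *-suc e (2 * i) =
    [m+o+[n∸o]]%n≡m (<⇒≤ (≤-<-trans (m≤n+m _ e) (e+low<n i<L))) (≤-<-trans (m≤m+n e _) (e+low<n i<L))

  low-high : ∀ {i} → i < L → (low i + (n ∸ high i)) % n ≡ n ∸ e
  low-high {i} i<L = trans (cong (_% n) low+[n∸high]≡n∸e) (m<n⇒m%n≡m (∸-monoʳ-< e>0 e≤n))
    where
    open ≡-Reasoning
    e≤n : e ≤ n
    e≤n = <⇒≤ (≤-<-trans (m≤m+n e _) (e+low<n i<L))
    low+[n∸high]≡n∸e : low i + (n ∸ high i) ≡ n ∸ e
    low+[n∸high]≡n∸e = begin
      low i + (n ∸ high i)       ≡⟨ cong (λ h → low i + (n ∸ h)) (*-suc e (2 * i)) ⟩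
      low i + (n ∸ (e + low i))  ≡⟨ cong (low i +_) (∸-+-assoc n e (low i)) ⟨
      low i + (n ∸ e ∸ low i)    ≡⟨ m+[n∸m]≡n (m+n≤o⇒m≤o∸n (low i) (subst (_≤ n) (+-comm e (low i))
                                                                          (<⇒≤ (e+low<n i<L)))) ⟩
      n ∸ e                      ∎

pairs-with-difference : ∀ {n L z} .{{_ : NonZero n}} → z > 0 → z < n → L * (2 * L) ≤ n →
  ∃[ a ] ∃[ b ] (DisjointPairs n L a b × (∀ {i} → i < L → (a i + (n ∸ b i)) % n ≡ z))
pairs-with-difference {n} {L} {z} z>0 z<n 2L²≤n with z ≤? L
... | yes z≤L = high , low , pairs , high-low
  where open Interleaved {L = L} z>0 (≤-trans (*-monoˡ-≤ (2 * L) z≤L) 2L²≤n)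
... | no z≰L with z + L ≤? n
...   | yes z+L≤n = (z +_) , (λ i → i) , pairs , differences
  where
  L≤z : L ≤ z
  L≤z = <⇒≤ (≰⇒> z≰L)
  pairs : DisjointPairs n L (z +_) (λ i → i)
  pairs = record
    { a<n = λ i<L → <-≤-trans (+-monoʳ-< z i<L) z+L≤n
    ; b<n = λ i<L → <-≤-trans i<L (≤-trans L≤z (<⇒≤ z<n))
    ; a≢b = λ {i} i<L j<L → <⇒≢ (<-≤-trans j<L (≤-trans L≤z (m≤m+n z i))) ∘ sym
    ; a-injective = λ _ _ → +-cancelˡ-≡ z _ _
    ; b-injective = λ _ _ i≡j → i≡j }
  differences : ∀ {i} → i < L → (z + i + (n ∸ i)) % n ≡ z
  differences i<L = [m+o+[n∸o]]%n≡m (<⇒≤ (<-≤-trans i<L (≤-trans L≤z (<⇒≤ z<n)))) z<n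
...   | no z+L≰n = low , high , DisjointPairs.swap pairs ,
                   λ i<L → trans (low-high i<L) (m∸[m∸n]≡n (<⇒≤ z<n))
  where
  n∸z≤L : n ∸ z ≤ L
  n∸z≤L = m≤n+o⇒m∸n≤o n z (<⇒≤ (≰⇒> z+L≰n))
  open Interleaved {L = L} (m<n⇒0<n∸m z<n) (≤-trans (*-monoˡ-≤ (2 * L) n∸z≤L) 2L²≤n)

-- Sets with full sumset and difference set

allᵇ : ∀ {k} → (Fin k → Bool) → Bool
allᵇ {zero}  F = true
allᵇ {suc k} F = F Fin.zero ∧ allᵇ (F ∘ Fin.suc)

allᵇ-lookup⇒≡⊤ : ∀ {k} (V : Subset k) → allᵇ (lookup V) ≡ true → V ≡ ⊤
allᵇ-lookup⇒≡⊤ []         _   = refl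
allᵇ-lookup⇒≡⊤ (true ∷ V) all = cong (true ∷_) (allᵇ-lookup⇒≡⊤ V all)

count-not-allᵇ-≤ : ∀ n k {c d} (F : Fin k → Vec Bool n → Bool) →
  (∀ z → c * count n (λ v → not (F z v)) ≤ d) →
  c * count n (λ v → not (allᵇ λ z → F z v)) ≤ k * d
count-not-allᵇ-≤ n zero    {c} F _ = ≤-reflexive (trans (cong (c *_) (count-false n)) (*-zeroʳ c))
count-not-allᵇ-≤ n (suc k) {c} {d} F bound = begin
  c * count n (λ v → not (F Fin.zero v ∧ rest v))            ≤⟨ *-monoʳ-≤ c (count-not-∧ n _ rest) ⟩
  c * (count n (not ∘ F Fin.zero) + count n (not ∘ rest))    ≡⟨ *-distribˡ-+ c _ _ ⟩
  c * count n (not ∘ F Fin.zero) + c * count n (not ∘ rest)  ≤⟨ +-mono-≤ (bound Fin.zero)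
                                                                  (count-not-allᵇ-≤ n k {c} (F ∘ Fin.suc) (bound ∘ Fin.suc)) ⟩
  suc k * d                                                  ∎
  where
  open ≤-Reasoning
  rest : Vec Bool n → Bool
  rest v = allᵇ λ z → F (Fin.suc z) v

length-filter-map : ∀ {A B : Set} {P : Pred B 0ℓ} (P? : Decidable P) (f : A → B) (xs : List A) →
  length (filter P? (map f xs)) ≡ length (filter (P? ∘ f) xs)
length-filter-map P? f []       = refl
length-filter-map P? f (x ∷ xs) with does (P? (f x))
... | true  = cong suc (length-filter-map P? f xs)
... | false = length-filter-map P? f xs

length-filter-allSubsets : ∀ n {P : Pred (Subset n) 0ℓ} (P? : Decidable P) →
  length (filter P? (allSubsets n)) ≡ count n (does ∘ P?)
length-filter-allSubsets zero P? with does (P? [])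
... | true  = refl
... | false = refl
length-filter-allSubsets (suc n) P? = begin
  length (filter P? (map (true ∷_) subsets ++ map (false ∷_) subsets))
    ≡⟨ cong length (filter-++ P? (map (true ∷_) subsets) (map (false ∷_) subsets)) ⟩
  length (filter P? (map (true ∷_) subsets) ++ filter P? (map (false ∷_) subsets))
    ≡⟨ length-++ (filter P? (map (true ∷_) subsets)) ⟩
  length (filter P? (map (true ∷_) subsets)) + length (filter P? (map (false ∷_) subsets))
    ≡⟨ cong₂ _+_ (trans (length-filter-map P? _ subsets) (length-filter-allSubsets n _))
                 (trans (length-filter-map P? _ subsets) (length-filter-allSubsets n _)) ⟩
  count (suc n) (does ∘ P?)
    ∎
  where
  open ≡-Reasoning
  subsets = allSubsets n

full : ∀ {n} → Subset n → Bool
full V = allᵇ (lookup V)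

full⇒good : ∀ {m} (S : Subset (suc m)) →
  (full (sumset S) ∧ full (diffset S)) ≡ true → does (good? S) ≡ true
full⇒good {m} S diff-full with full (sumset S) in sum-full
... | true = dec-true (good? S) (∣full∣ (sumset S) sum-full , ∣full∣ (diffset S) diff-full)
  where
  ∣full∣ : ∀ (V : Subset (suc m)) → full V ≡ true → ∣ V ∣ ≡ suc m
  ∣full∣ V V-full = trans (cong ∣_∣ (allᵇ-lookup⇒≡⊤ V V-full)) (∣⊤∣≡n (suc m))

count-bad : ∀ m → 2 ^ suc m ∸ goodCount m ≡ count (suc m) (λ S → not (does (good? S)))
count-bad m = begin
  2 ^ n ∸ goodCount m                                ≡⟨ cong (2 ^ n ∸_) (length-filter-allSubsets n good?) ⟩
  2 ^ n ∸ count n good                               ≡⟨ cong (_∸ count n good) (count-+-count-not n good) ⟨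
  count n good + count n (not ∘ good) ∸ count n good ≡⟨ m+n∸m≡n (count n good) _ ⟩
  count n (not ∘ good)                               ∎
  where
  open ≡-Reasoning
  n = suc m
  good : Subset n → Bool
  good S = does (good? S)

pairset-missing-≤ : ∀ {n L a b} (_⊕_ : ℕ → ℕ → ℕ) (z : Fin n) → DisjointPairs n L a b →
  (∀ {i} → i < L → a i ⊕ b i ≡ toℕ z) →
  4 ^ L * count n (λ S → not (lookup (pairset _⊕_ S) z)) ≤ 3 ^ L * 2 ^ n
pairset-missing-≤ _⊕_ z pairs a⊕b≡z = count-missing-≤ pairs _ λ S i<L ai∈S bi∈S →
  pairset-hit _⊕_ S z (a<n i<L) (b<n i<L) ai∈S bi∈S (a⊕b≡z i<L)
  where open DisjointPairs pairs

sumset-missing-≤ : ∀ {m L} → 4 * L ≤ suc m → (z : Fin (suc m)) →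
  4 ^ L * count (suc m) (λ S → not (lookup (sumset S) z)) ≤ 3 ^ L * 2 ^ suc m
sumset-missing-≤ {m} {L} 4L≤n z with _ , _ , pairs , sums ← pairs-with-sum {L = L} (toℕ<n z) 4L≤n =
  pairset-missing-≤ (λ x y → (x + y) % suc m) z pairs sums

diffset-missing-≤ : ∀ {m L} → 4 * L ≤ suc m → L * (2 * L) ≤ suc m → (z : Fin (suc m)) →
  4 ^ L * count (suc m) (λ S → not (lookup (diffset S) z)) ≤ 3 ^ L * 2 ^ suc m
diffset-missing-≤ {m} {L} 4L≤n 2L²≤n z with toℕ z in z≡
-- 0 ∈ S - S as soon as S meets any of the pairs, so any disjoint pairs will do.
... | zero with _ , _ , pairs , _ ← pairs-with-sum {L = L} {z = 0} z<s 4L≤n =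
  count-missing-≤ pairs (λ S → lookup (diffset S) z) λ S i<L ai∈S _ →
    pairset-hit (λ x y → (x + (suc m ∸ y)) % suc m) S z (a<n i<L) (a<n i<L) ai∈S ai∈S
      (trans (cong (_% suc m) (m+[n∸m]≡n (<⇒≤ (a<n i<L)))) (trans (n%n≡0 (suc m)) (sym z≡)))
  where open DisjointPairs pairs
... | suc d with _ , _ , pairs , differences ←
                 pairs-with-difference {L = L} z<s (subst (_< suc m) z≡ (toℕ<n z)) 2L²≤n =
  pairset-missing-≤ (λ x y → (x + (suc m ∸ y)) % suc m) z pairs (λ i<L → trans (differences i<L) (sym z≡))

bad-bound : ∀ {m L} → 4 * L ≤ suc m → L * (2 * L) ≤ suc m →
  4 ^ L * (2 ^ suc m ∸ goodCount m) ≤ suc m * (2 * 3 ^ L) * 2 ^ suc m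
bad-bound {m} {L} 4L≤n 2L²≤n = begin
  4 ^ L * (2 ^ n ∸ goodCount m)
    ≡⟨ cong (4 ^ L *_) (count-bad m) ⟩
  4 ^ L * count n (λ S → not (does (good? S)))
    ≤⟨ *-monoʳ-≤ (4 ^ L) (count-not-mono n full⇒good) ⟩
  4 ^ L * count n (λ S → not (sum-full S ∧ diff-full S))
    ≤⟨ *-monoʳ-≤ (4 ^ L) (count-not-∧ n sum-full diff-full) ⟩
  4 ^ L * (count n (not ∘ sum-full) + count n (not ∘ diff-full))
    ≡⟨ *-distribˡ-+ (4 ^ L) (count n (not ∘ sum-full)) (count n (not ∘ diff-full)) ⟩
  4 ^ L * count n (not ∘ sum-full) + 4 ^ L * count n (not ∘ diff-full)
    ≤⟨ +-mono-≤ (count-not-allᵇ-≤ n n {4 ^ L} (λ z S → lookup (sumset S) z)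
                                  (sumset-missing-≤ {L = L} 4L≤n))
                (count-not-allᵇ-≤ n n {4 ^ L} (λ z S → lookup (diffset S) z)
                                  (diffset-missing-≤ {L = L} 4L≤n 2L²≤n)) ⟩
  n * (3 ^ L * 2 ^ n) + n * (3 ^ L * 2 ^ n)
    ≡⟨ regroup n (3 ^ L) (2 ^ n) ⟩
  n * (2 * 3 ^ L) * 2 ^ n
    ∎
  where
  open ≤-Reasoning
  n = suc m
  sum-full diff-full : Subset n → Bool
  sum-full S  = full (sumset S)
  diff-full S = full (diffset S)
  regroup : ∀ n x y → n * (x * y) + n * (x * y) ≡ n * (2 * x) * y
  regroup = solve-∀

-- Choosing the number of pairs

n<2^n : ∀ n → n < 2 ^ n
n<2^n zero    = s≤s z≤n
n<2^n (suc n) = ≤-trans (+-mono-≤ (m^n>0 2 n) (n<2^n n)) (≤-reflexive (cong (2 ^ n +_) (sym (+-identityʳ _))))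

log₂-bracket : ∀ {n} t → n > 0 → n < 2 ^ t → ∃[ ℓ ] (2 ^ ℓ ≤ n × n < 2 ^ suc ℓ)
log₂-bracket zero n>0 n<1 = contradiction n>0 (<⇒≱ n<1)
log₂-bracket {n} (suc t) n>0 n<2^1+t with n <? 2 ^ t
... | yes n<2^t = log₂-bracket t n>0 n<2^t
... | no  n≮2^t = t , ≮⇒≥ n≮2^t , n<2^1+t

72ℓ²≤2^ℓ : ∀ {ℓ} → 14 ≤ ℓ → 72 * (ℓ * ℓ) ≤ 2 ^ ℓ
72ℓ²≤2^ℓ {ℓ} 14≤ℓ = subst (λ x → 72 * (x * x) ≤ 2 ^ x) (m+[n∸m]≡n 14≤ℓ) (from14 (ℓ ∸ 14))
  where
  doubling : ∀ t → 72 * ((15 + t) * (15 + t)) + 72 * (167 + 26 * t + t * t)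
                 ≡ 2 * (72 * ((14 + t) * (14 + t)))
  doubling = solve-∀
  from14 : ∀ t → 72 * ((14 + t) * (14 + t)) ≤ 2 ^ (14 + t)
  from14 zero    = ≤ᵇ⇒≤ 14112 16384 tt
  from14 (suc t) = ≤-trans (m≤m+n _ _) (≤-trans (≤-reflexive (doubling t)) (*-monoʳ-≤ 2 (from14 t)))

^-distribʳ-* : ∀ a b ℓ → (a * b) ^ ℓ ≡ a ^ ℓ * b ^ ℓ
^-distribʳ-* a b zero    = refl
^-distribʳ-* a b (suc ℓ) = trans (cong (a * b *_) (^-distribʳ-* a b ℓ)) (*-interchange a b (a ^ ℓ) (b ^ ℓ))

power-gap : ∀ k {n ℓ} → k + 2 ≤ ℓ → n < 2 ^ suc ℓ → suc k * (n * (2 * 3 ^ (6 * ℓ))) ≤ 4 ^ (6 * ℓ)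
power-gap k {n} {ℓ} k+2≤ℓ n<2^1+ℓ = begin
  suc k * (n * (2 * 3 ^ (6 * ℓ)))      ≡⟨ cong (λ x → suc k * (n * (2 * x))) (^-*-assoc 3 6 ℓ) ⟨
  suc k * (n * (2 * 729 ^ ℓ))          ≤⟨ *-monoʳ-≤ (suc k) (*-monoˡ-≤ (2 * 729 ^ ℓ) (<⇒≤ n<2^1+ℓ)) ⟩
  suc k * (2 ^ suc ℓ * (2 * 729 ^ ℓ))  ≡⟨ regroup (suc k) (2 ^ ℓ) (729 ^ ℓ) ⟩
  4 * suc k * (2 ^ ℓ * 729 ^ ℓ)        ≤⟨ *-monoˡ-≤ (2 ^ ℓ * 729 ^ ℓ) 4[1+k]≤2^ℓ ⟩
  2 ^ ℓ * (2 ^ ℓ * 729 ^ ℓ)            ≡⟨ cong (2 ^ ℓ *_) (^-distribʳ-* 2 729 ℓ) ⟨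
  2 ^ ℓ * 1458 ^ ℓ                     ≡⟨ ^-distribʳ-* 2 1458 ℓ ⟨
  2916 ^ ℓ                             ≤⟨ ^-monoˡ-≤ ℓ (≤ᵇ⇒≤ 2916 4096 tt) ⟩
  4096 ^ ℓ                             ≡⟨ ^-*-assoc 4 6 ℓ ⟩
  4 ^ (6 * ℓ)                          ∎
  where
  open ≤-Reasoning
  regroup : ∀ s a b → s * ((2 * a) * (2 * b)) ≡ 4 * s * (a * b)
  regroup = solve-∀
  4[1+k]≤2^ℓ : 4 * suc k ≤ 2 ^ ℓ
  4[1+k]≤2^ℓ = begin
    4 * suc k    ≤⟨ *-monoʳ-≤ 4 (n<2^n k) ⟩
    4 * 2 ^ k    ≡⟨ *-comm 4 (2 ^ k) ⟩
    2 ^ k * 4    ≡⟨ ^-distribˡ-+-* 2 k 2 ⟨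
    2 ^ (k + 2)  ≤⟨ ^-monoʳ-≤ 2 k+2≤ℓ ⟩
    2 ^ ℓ        ∎

enough-pairs : ∀ k {n} → 2 ^ (k + 14) ≤ n →
  ∃[ L ] (4 * L ≤ n × L * (2 * L) ≤ n × suc k * (n * (2 * 3 ^ L)) ≤ 4 ^ L)
enough-pairs k {n} N≤n with ℓ , 2^ℓ≤n , n<2^1+ℓ ← log₂-bracket n (≤-trans (m^n>0 2 (k + 14)) N≤n) (n<2^n n)
  = 6 * ℓ , bounds ℓ 2^ℓ≤n n<2^1+ℓ
  where
  bounds : ∀ ℓ → 2 ^ ℓ ≤ n → n < 2 ^ suc ℓ →
    4 * (6 * ℓ) ≤ n × 6 * ℓ * (2 * (6 * ℓ)) ≤ n × suc k * (n * (2 * 3 ^ (6 * ℓ))) ≤ 4 ^ (6 * ℓ)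
  bounds ℓ 2^ℓ≤n n<2^1+ℓ = 4L≤n , 2L²≤n , power-gap k (≤-trans (+-monoʳ-≤ k (≤ᵇ⇒≤ 2 14 tt)) k+14≤ℓ) n<2^1+ℓ
    where
    L = 6 * ℓ
    k+14≤ℓ : k + 14 ≤ ℓ
    k+14≤ℓ = ≮⇒≥ λ ℓ<k+14 → <⇒≱ n<2^1+ℓ (≤-trans (^-monoʳ-≤ 2 ℓ<k+14) N≤n)
    14≤ℓ : 14 ≤ ℓ
    14≤ℓ = ≤-trans (m≤n+m 14 k) k+14≤ℓ
    2[6ℓ]²≡72ℓ² : ∀ ℓ → 6 * ℓ * (2 * (6 * ℓ)) ≡ 72 * (ℓ * ℓ)
    2[6ℓ]²≡72ℓ² = solve-∀
    2L²≤n : L * (2 * L) ≤ n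
    2L²≤n = ≤-trans (≤-reflexive (2[6ℓ]²≡72ℓ² ℓ)) (≤-trans (72ℓ²≤2^ℓ 14≤ℓ) 2^ℓ≤n)
    2≤L : 2 ≤ L
    2≤L = ≤-trans (s≤s (s≤s z≤n)) (*-monoʳ-≤ 6 (≤-trans (s≤s z≤n) 14≤ℓ))
    4L≤n : 4 * L ≤ n
    4L≤n = ≤-trans (≤-trans (≤-reflexive (*-comm 4 L)) (*-monoʳ-≤ L (*-monoʳ-≤ 2 2≤L))) 2L²≤n

proposition1 : (k : ℕ) → ∃[ N ] ((m : ℕ) → N ≤ suc m →
                 suc k * (2 ^ suc m ∸ goodCount m) ≤ 2 ^ suc m)
proposition1 k = 2 ^ (k + 14) , λ m N≤n → bad-fraction m (enough-pairs k N≤n)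
  where
  bad-fraction : ∀ m → ∃[ L ] (4 * L ≤ suc m × L * (2 * L) ≤ suc m ×
                                suc k * (suc m * (2 * 3 ^ L)) ≤ 4 ^ L) →
                 suc k * (2 ^ suc m ∸ goodCount m) ≤ 2 ^ suc m
  bad-fraction m (L , 4L≤n , 2L²≤n , large) = *-cancelˡ-≤ (4 ^ L) {{m^n≢0 4 L}} (begin
    4 ^ L * (suc k * bad)                ≡⟨ x*[y*z]≡y*[x*z] (4 ^ L) (suc k) bad ⟩
    suc k * (4 ^ L * bad)                ≤⟨ *-monoʳ-≤ (suc k) (bad-bound {L = L} 4L≤n 2L²≤n) ⟩
    suc k * (n * (2 * 3 ^ L) * 2 ^ n)    ≡⟨ *-assoc (suc k) (n * (2 * 3 ^ L)) (2 ^ n) ⟨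
    suc k * (n * (2 * 3 ^ L)) * 2 ^ n    ≤⟨ *-monoˡ-≤ (2 ^ n) large ⟩
    4 ^ L * 2 ^ n                        ∎)
    where
    open ≤-Reasoning
    n = suc m
    bad = 2 ^ n ∸ goodCount m
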